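{- In CBN, $\to_F^{*} \;=\; \to_S^{*}\,\to_I^{*}$; and in CBV, $\to_F^{*} \;=\; \to_S^{*}\,\to_I^{*}$.
   Context: CBN/CBV calculi: terms $t,u ::= v \mid t\,u \mid t[x\backslash u]$ (explicit substitution $t[x\backslash u]$ binds $x$ in $t$), values $v ::= x \mid \lambda x.t$; full contexts $F ::= \diamond \mid F\,t \mid t\,F \mid \lambda x.F \mid F[x\backslash t] \mid t[x\backslash F]$, list contexts $L ::= \diamond \mid L[x\backslash t]$. CBN rules (capture-free): $(L\langle\lambda x.t\rangle)\,u \mapsto_{\mathtt{dB}} L\langle t[x\backslash u]\rangle$ and $t[x\backslash u] \mapsto_{\mathtt{s}} t\{x:=u\}$ (meta-level substitution). CBV rules: the same $\mathtt{dB}$ and $t[x\backslash L\langle v\rangle] \mapsto_{\mathtt{sV}} L\langle t\{x:=v\}\rangle$ with $v$ a value. CBN surface contexts $S ::= \diamond \mid S\,t \mid \lambda x.S \mid S[x\backslash t]$; CBN internal contexts $I ::= t\,F \mid t[x\backslash F] \mid S^{*}\langle I\rangle$ ($S^{*}$ a non-empty CBN surface context). CBV surface contexts $S ::= \diamond \mid S\,t \mid t\,S \mid S[x\backslash t] \mid t[x\backslash S]$; CBV internal contexts $I ::= \lambda x.F \mid S^{*}\langle I\rangle$ ($S^{*}$ a non-empty CBV surface context). In each calculus, full reduction $\to_F$, surface reduction $\to_S$ and internal reduction $\to_I$ are the closures of that calculus's rules under its full, surface and internal contexts respectively; $\to^{*}$ denotes reflexive-transitive closure and juxtaposition denotes relational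 composition. -}

module Defs where

open import Data.Nat using (ℕ; suc)
open import Data.Fin using (Fin; zero; suc)
open import Data.Product using (∃; _×_)
open import Relation.Binary.Construct.Closure.ReflexiveTransitive using (Star)

-- Tm n : terms with at most n free variables (variable 0 = innermost binder).
--   t,u ::= x | λx.t | t u | t[x\u]     (es t u = t[x\u], binds x in t)

data Tm (n : ℕ) : Set where
  var : Fin n → Tm n
  lam : Tm (suc n) → Tm n
  app : Tm n → Tm n → Tm n
  es  : Tm (suc n) → Tm n → Tm n

data Value {n : ℕ} : Tm n → Set where
  var : (x : Fin n) → Value (var x)
  lam : (t : Tm (suc n)) → Value (lam t)

liftR : {n m : ℕ} → (Fin n → Fin m) → Fin (suc n) → Fin (suc m)
liftR ρ zero    = zero
liftR ρ (suc x) = suc (ρ x)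

ren : {n m : ℕ} → (Fin n → Fin m) → Tm n → Tm m
ren ρ (var x)  = var (ρ x)
ren ρ (lam t)  = lam (ren (liftR ρ) t)
ren ρ (app t u) = app (ren ρ t) (ren ρ u)
ren ρ (es t u) = es (ren (liftR ρ) t) (ren ρ u)

liftS : {n m : ℕ} → (Fin n → Tm m) → Fin (suc n) → Tm (suc m)
liftS σ zero    = var zero
liftS σ (suc x) = ren suc (σ x)

sub : {n m : ℕ} → (Fin n → Tm m) → Tm n → Tm m
sub σ (var x)  = σ x
sub σ (lam t)  = lam (sub (liftS σ) t)
sub σ (app t u) = app (sub σ t) (sub σ u)
sub σ (es t u) = es (sub (liftS σ) t) (sub σ u)

-- t{x:=u}, where x is variable 0 of t
sub0 : {n : ℕ} → Tm (suc n) → Tm n → Tm n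
sub0 {n} t u = sub σ t
  where
  σ : Fin (suc n) → Tm n
  σ zero    = u
  σ (suc x) = var x

-- List contexts L ::= ◇ | L[x\t].
-- LCtx n m : the whole term lives in scope n, the hole in scope m.

data LCtx (n : ℕ) : ℕ → Set where
  hole : LCtx n n
  esL  : {m : ℕ} → LCtx (suc n) m → Tm n → LCtx n m

plugL : {n m : ℕ} → LCtx n m → Tm m → Tm n
plugL hole       t = t
plugL (esL L u)  t = es (plugL L t) u

-- weakening of the outer scope past the binders of L
wkL : {n m : ℕ} → LCtx n m → Fin n → Fin m
wkL hole      x = x
wkL (esL L u) x = wkL L (suc x)

-- Rewrite rules at the root (capture-freeness is handled by de Bruijn shifting)

Rel : Set₁
Rel = {n : ℕ} → Tm n → Tm n → Set

-- (L⟨λx.t⟩) u ↦dB L⟨t[x\u]⟩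
data dBR : Rel where
  dB-rule : {n m : ℕ} (L : LCtx n m) (t : Tm (suc m)) (u : Tm n) →
            dBR (app (plugL L (lam t)) u) (plugL L (es t (ren (wkL L) u)))

data sR : Rel where
  s-rule : {n : ℕ} (t : Tm (suc n)) (u : Tm n) → sR (es t u) (sub0 t u)

-- t[x\L⟨v⟩] ↦sV L⟨t{x:=v}⟩   (v a value)
data sVR : Rel where
  sV-rule : {n m : ℕ} (t : Tm (suc n)) (L : LCtx n m) (v : Tm m) → Value v →
            sVR (es t (plugL L v)) (plugL L (sub0 (ren (liftR (wkL L)) t) v))

data CBNrule : Rel where
  dB : {n : ℕ} {t u : Tm n} → dBR t u → CBNrule t u
  s  : {n : ℕ} {t u : Tm n} → sR t u → CBNrule t u

data CBVrule : Rel where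
  dB : {n : ℕ} {t u : Tm n} → dBR t u → CBVrule t u
  sV : {n : ℕ} {t u : Tm n} → sVR t u → CBVrule t u

data Full (R : Rel) : Rel where
  root : {n : ℕ} {t u : Tm n} → R t u → Full R t u
  appL : {n : ℕ} {t t' u : Tm n} → Full R t t' → Full R (app t u) (app t' u)
  appR : {n : ℕ} {t u u' : Tm n} → Full R u u' → Full R (app t u) (app t u')
  lam  : {n : ℕ} {t t' : Tm (suc n)} → Full R t t' → Full R (lam t) (lam t')
  esL  : {n : ℕ} {t t' : Tm (suc n)} {u : Tm n} → Full R t t' → Full R (es t u) (es t' u)
  esR  : {n : ℕ} {t : Tm (suc n)} {u u' : Tm n} → Full R u u' → Full R (es t u) (es t u')

data SurfN (R : Rel) : Rel where
  root : {n : ℕ} {t u : Tm n} → R t u → SurfN R t u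
  appL : {n : ℕ} {t t' u : Tm n} → SurfN R t t' → SurfN R (app t u) (app t' u)
  lam  : {n : ℕ} {t t' : Tm (suc n)} → SurfN R t t' → SurfN R (lam t) (lam t')
  esL  : {n : ℕ} {t t' : Tm (suc n)} {u : Tm n} → SurfN R t t' → SurfN R (es t u) (es t' u)

-- CBN internal contexts I ::= t F | t[x\F] | S*⟨I⟩  (S* non-empty CBN surface)
data IntN (R : Rel) : Rel where
  appR : {n : ℕ} {t u u' : Tm n} → Full R u u' → IntN R (app t u) (app t u')
  esR  : {n : ℕ} {t : Tm (suc n)} {u u' : Tm n} → Full R u u' → IntN R (es t u) (es t u')
  appL : {n : ℕ} {t t' u : Tm n} → IntN R t t' → IntN R (app t u) (app t' u)
  lam  : {n : ℕ} {t t' : Tm (suc n)} → IntN R t t' → IntN R (lam t) (lam t')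
  esL  : {n : ℕ} {t t' : Tm (suc n)} {u : Tm n} → IntN R t t' → IntN R (es t u) (es t' u)

data SurfV (R : Rel) : Rel where
  root : {n : ℕ} {t u : Tm n} → R t u → SurfV R t u
  appL : {n : ℕ} {t t' u : Tm n} → SurfV R t t' → SurfV R (app t u) (app t' u)
  appR : {n : ℕ} {t u u' : Tm n} → SurfV R u u' → SurfV R (app t u) (app t u')
  esL  : {n : ℕ} {t t' : Tm (suc n)} {u : Tm n} → SurfV R t t' → SurfV R (es t u) (es t' u)
  esR  : {n : ℕ} {t : Tm (suc n)} {u u' : Tm n} → SurfV R u u' → SurfV R (es t u) (es t u')

-- CBV internal contexts I ::= λx.F | S*⟨I⟩  (S* non-empty CBV surface)
data IntV (R : Rel) : Rel where
  lam  : {n : ℕ} {t t' : Tm (suc n)} → Full R t t' → IntV R (lam t) (lam t')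
  appL : {n : ℕ} {t t' u : Tm n} → IntV R t t' → IntV R (app t u) (app t' u)
  appR : {n : ℕ} {t u u' : Tm n} → IntV R u u' → IntV R (app t u) (app t u')
  esL  : {n : ℕ} {t t' : Tm (suc n)} {u : Tm n} → IntV R t t' → IntV R (es t u) (es t' u)
  esR  : {n : ℕ} {t : Tm (suc n)} {u u' : Tm n} → IntV R u u' → IntV R (es t u) (es t u')

_* : Rel → Rel
(R *) t u = Star R t u

_⨾_ : Rel → Rel → Rel
(R ⨾ Q) {n} t u = ∃ λ (s : Tm n) → R t s × Q s u

_≐_ : Rel → Rel → Set
R ≐ Q = {n : ℕ} (t u : Tm n) → (R t u → Q t u) × (Q t u → R t u)

→F-CBN →S-CBN →I-CBN →F-CBV →S-CBV →I-CBV : Rel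
→F-CBN = Full CBNrule
→S-CBN = SurfN CBNrule
→I-CBN = IntN CBNrule
→F-CBV = Full CBVrule
→S-CBV = SurfV CBVrule
→I-CBV = IntV CBVrule

-- A standard reduction t ⇛ u consists of surface steps followed by standard reductions of the
-- immediate subterms. Appending a full step to a standard reduction yields a standard reduction: a
-- step inside a subterm is absorbed by that subterm's reduction; for a root step, standard
-- reduction reflects the shape of the redex (list contexts, abstractions, values), so the redex can
-- be fired earlier as a surface step, and what remains is standard because standard reduction is
-- stable under substitution. Hence →F* and ⇛ coincide, and a standard reduction splits into a
-- surface part followed by an internal part by following the surface positions of the calculus.
module Submission where

open import Defs
open import Data.Nat using (ℕ; suc)
open import Data.Fin using (Fin; zero; suc)
open import Data.Unit using (⊤; tt)
open import Data.Product using (_×_; _,_)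
open import Function using (id; _∘_)
open import Relation.Binary.PropositionalEquality
open import Relation.Binary.Construct.Closure.ReflexiveTransitive using (Star; ε; _◅_; _◅◅_; gmap; map)

private
  variable
    n n' m m' k : ℕ

liftR-cong : {ρ ρ' : Fin n → Fin m} → ρ ≗ ρ' → liftR ρ ≗ liftR ρ'
liftR-cong e zero    = refl
liftR-cong e (suc x) = cong suc (e x)

ren-cong : {ρ ρ' : Fin n → Fin m} → ρ ≗ ρ' → ∀ t → ren ρ t ≡ ren ρ' t
ren-cong e (var x)   = cong var (e x)
ren-cong e (lam t)   = cong lam (ren-cong (liftR-cong e) t)
ren-cong e (app t u) = cong₂ app (ren-cong e t) (ren-cong e u)
ren-cong e (es t u)  = cong₂ es (ren-cong (liftR-cong e) t) (ren-cong e u)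

liftS-cong : {σ σ' : Fin n → Tm m} → σ ≗ σ' → liftS σ ≗ liftS σ'
liftS-cong e zero    = refl
liftS-cong e (suc x) = cong (ren suc) (e x)

sub-cong : {σ σ' : Fin n → Tm m} → σ ≗ σ' → ∀ t → sub σ t ≡ sub σ' t
sub-cong e (var x)   = e x
sub-cong e (lam t)   = cong lam (sub-cong (liftS-cong e) t)
sub-cong e (app t u) = cong₂ app (sub-cong e t) (sub-cong e u)
sub-cong e (es t u)  = cong₂ es (sub-cong (liftS-cong e) t) (sub-cong e u)

liftR-∘ : (ρ : Fin m → Fin k) (ρ' : Fin n → Fin m) → liftR ρ ∘ liftR ρ' ≗ liftR (ρ ∘ ρ')
liftR-∘ ρ ρ' zero    = refl
liftR-∘ ρ ρ' (suc x) = refl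

ren-ren : (ρ : Fin m → Fin k) (ρ' : Fin n → Fin m) → ∀ t → ren ρ (ren ρ' t) ≡ ren (ρ ∘ ρ') t
ren-ren ρ ρ' (var x)   = refl
ren-ren ρ ρ' (lam t)   = cong lam (trans (ren-ren _ _ t) (ren-cong (liftR-∘ ρ ρ') t))
ren-ren ρ ρ' (app t u) = cong₂ app (ren-ren ρ ρ' t) (ren-ren ρ ρ' u)
ren-ren ρ ρ' (es t u)  = cong₂ es (trans (ren-ren _ _ t) (ren-cong (liftR-∘ ρ ρ') t)) (ren-ren ρ ρ' u)

liftS-liftR : (σ : Fin m → Tm k) (ρ : Fin n → Fin m) → liftS σ ∘ liftR ρ ≗ liftS (σ ∘ ρ)
liftS-liftR σ ρ zero    = refl
liftS-liftR σ ρ (suc x) = refl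

sub-ren : (σ : Fin m → Tm k) (ρ : Fin n → Fin m) → ∀ t → sub σ (ren ρ t) ≡ sub (σ ∘ ρ) t
sub-ren σ ρ (var x)   = refl
sub-ren σ ρ (lam t)   = cong lam (trans (sub-ren _ _ t) (sub-cong (liftS-liftR σ ρ) t))
sub-ren σ ρ (app t u) = cong₂ app (sub-ren σ ρ t) (sub-ren σ ρ u)
sub-ren σ ρ (es t u)  = cong₂ es (trans (sub-ren _ _ t) (sub-cong (liftS-liftR σ ρ) t)) (sub-ren σ ρ u)

liftR-liftS : (ρ : Fin m → Fin k) (σ : Fin n → Tm m) → ren (liftR ρ) ∘ liftS σ ≗ liftS (ren ρ ∘ σ)
liftR-liftS ρ σ zero    = refl
liftR-liftS ρ σ (suc x) = trans (ren-ren _ suc (σ x)) (sym (ren-ren suc ρ (σ x)))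

ren-sub : (ρ : Fin m → Fin k) (σ : Fin n → Tm m) → ∀ t → ren ρ (sub σ t) ≡ sub (ren ρ ∘ σ) t
ren-sub ρ σ (var x)   = refl
ren-sub ρ σ (lam t)   = cong lam (trans (ren-sub _ _ t) (sub-cong (liftR-liftS ρ σ) t))
ren-sub ρ σ (app t u) = cong₂ app (ren-sub ρ σ t) (ren-sub ρ σ u)
ren-sub ρ σ (es t u)  = cong₂ es (trans (ren-sub _ _ t) (sub-cong (liftR-liftS ρ σ) t)) (ren-sub ρ σ u)

liftS-liftS : (σ : Fin m → Tm k) (σ' : Fin n → Tm m) → sub (liftS σ) ∘ liftS σ' ≗ liftS (sub σ ∘ σ')
liftS-liftS σ σ' zero    = refl
liftS-liftS σ σ' (suc x) = trans (sub-ren _ suc (σ' x)) (sym (ren-sub suc σ (σ' x)))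

sub-sub : (σ : Fin m → Tm k) (σ' : Fin n → Tm m) → ∀ t → sub σ (sub σ' t) ≡ sub (sub σ ∘ σ') t
sub-sub σ σ' (var x)   = refl
sub-sub σ σ' (lam t)   = cong lam (trans (sub-sub _ _ t) (sub-cong (liftS-liftS σ σ') t))
sub-sub σ σ' (app t u) = cong₂ app (sub-sub σ σ' t) (sub-sub σ σ' u)
sub-sub σ σ' (es t u)  = cong₂ es (trans (sub-sub _ _ t) (sub-cong (liftS-liftS σ σ') t)) (sub-sub σ σ' u)

liftS-var : liftS {n} var ≗ var
liftS-var zero    = refl
liftS-var (suc x) = refl

sub-var : (t : Tm n) → sub var t ≡ t
sub-var (var x)   = refl
sub-var (lam t)   = cong lam (trans (sub-cong liftS-var t) (sub-var t))
sub-var (app t u) = cong₂ app (sub-var t) (sub-var u)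
sub-var (es t u)  = cong₂ es (trans (sub-cong liftS-var t) (sub-var t)) (sub-var u)

ren-as-sub : (ρ : Fin n → Fin m) → ∀ t → ren ρ t ≡ sub (var ∘ ρ) t
ren-as-sub ρ t = trans (sym (sub-var (ren ρ t))) (sub-ren var ρ t)

ren-id : (t : Tm n) → ren id t ≡ t
ren-id t = trans (ren-as-sub id t) (sub-var t)

sub-ren-square : {τ : Fin m → Tm m'} {ρ : Fin n → Fin m} {ρ' : Fin n' → Fin m'} {σ : Fin n → Tm n'} →
                 (∀ x → τ (ρ x) ≡ ren ρ' (σ x)) → ∀ t → sub τ (ren ρ t) ≡ ren ρ' (sub σ t)
sub-ren-square {τ = τ} {ρ} {ρ'} {σ} e t = begin
  sub τ (ren ρ t)  ≡⟨ sub-ren τ ρ t ⟩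
  sub (τ ∘ ρ) t    ≡⟨ sub-cong e t ⟩
  sub (ren ρ' ∘ σ) t ≡⟨ sym (ren-sub ρ' σ t) ⟩
  ren ρ' (sub σ t) ∎
  where open ≡-Reasoning

liftS-square : {τ : Fin m → Tm m'} {ρ : Fin n → Fin m} {ρ' : Fin n' → Fin m'} {σ : Fin n → Tm n'} →
               (∀ x → τ (ρ x) ≡ ren ρ' (σ x)) → ∀ x → liftS τ (liftR ρ x) ≡ ren (liftR ρ') (liftS σ x)
liftS-square e zero = refl
liftS-square {ρ' = ρ'} {σ} e (suc x) =
  trans (cong (ren suc) (e x)) (trans (ren-ren suc ρ' (σ x)) (sym (ren-ren (liftR ρ') suc (σ x))))

σ₀ : Tm n → Fin (suc n) → Tm n
σ₀ u zero    = u
σ₀ u (suc x) = var x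

sub0-σ₀ : (t : Tm (suc n)) (u : Tm n) → sub0 t u ≡ sub (σ₀ u) t
sub0-σ₀ t u = sub-cong (λ { zero → refl ; (suc x) → refl }) t

σ₀-liftS : (σ : Fin n → Tm m) (u : Tm n) → sub σ ∘ σ₀ u ≗ sub (σ₀ (sub σ u)) ∘ liftS σ
σ₀-liftS σ u zero    = refl
σ₀-liftS σ u (suc x) = sym (trans (sub-ren _ suc (σ x)) (sub-var (σ x)))

sub-sub0 : (σ : Fin n → Tm m) (t : Tm (suc n)) (u : Tm n) →
           sub σ (sub0 t u) ≡ sub0 (sub (liftS σ) t) (sub σ u)
sub-sub0 σ t u = begin
  sub σ (sub0 t u)                                ≡⟨ cong (sub σ) (sub0-σ₀ t u) ⟩
  sub σ (sub (σ₀ u) t)                            ≡⟨ sub-sub σ (σ₀ u) t ⟩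
  sub (sub σ ∘ σ₀ u) t                            ≡⟨ sub-cong (σ₀-liftS σ u) t ⟩
  sub (sub (σ₀ (sub σ u)) ∘ liftS σ) t            ≡⟨ sym (sub-sub _ _ t) ⟩
  sub (σ₀ (sub σ u)) (sub (liftS σ) t)            ≡⟨ sym (sub0-σ₀ (sub (liftS σ) t) (sub σ u)) ⟩
  sub0 (sub (liftS σ) t) (sub σ u)                ∎
  where open ≡-Reasoning

Value-ren : (ρ : Fin n → Fin m) {v : Tm n} → Value v → Value (ren ρ v)
Value-ren ρ (var x) = var (ρ x)
Value-ren ρ (lam t) = lam _

Value-sub : {σ : Fin n → Tm m} → (∀ x → Value (σ x)) → {v : Tm n} → Value v → Value (sub σ v)
Value-sub vals (var x) = vals x
Value-sub vals (lam t) = lam _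

liftS-Value : {σ : Fin n → Tm m} → (∀ x → Value (σ x)) → ∀ x → Value (liftS σ x)
liftS-Value vals zero    = var zero
liftS-Value vals (suc x) = Value-ren suc (vals x)

record SubstL (σ : Fin n → Tm n') (L : LCtx n m) : Set where
  field
    {hole-scope} : ℕ
    ctx   : LCtx n' hole-scope
    inner : Fin m → Tm hole-scope
    plug  : ∀ t → sub σ (plugL L t) ≡ plugL ctx (sub inner t)
    wk    : ∀ x → inner (wkL L x) ≡ ren (wkL ctx) (σ x)
    value : (∀ x → Value (σ x)) → ∀ x → Value (inner x)

substL : (σ : Fin n → Tm n') (L : LCtx n m) → SubstL σ L
substL σ hole = record
  { ctx   = hole
  ; inner = σ
  ; plug  = λ _ → refl
  ; wk    = λ x → sym (ren-id (σ x))
  ; value = id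
  }
substL σ (esL L u) = record
  { ctx   = esL ctx (sub σ u)
  ; inner = inner
  ; plug  = λ t → cong (λ z → es z (sub σ u)) (plug t)
  ; wk    = λ x → trans (wk (suc x)) (ren-ren (wkL ctx) suc (σ x))
  ; value = value ∘ liftS-Value
  }
  where open SubstL (substL (liftS σ) L)

dB-sub : (σ : Fin n → Tm m) {a b : Tm n} → dBR a b → dBR (sub σ a) (sub σ b)
dB-sub σ (dB-rule L t u) = subst₂ dBR (sym redex) (sym reduct) (dB-rule ctx (sub (liftS inner) t) (sub σ u))
  where
  open SubstL (substL σ L)
  redex : sub σ (app (plugL L (lam t)) u) ≡ app (plugL ctx (lam (sub (liftS inner) t))) (sub σ u)
  redex = cong (λ z → app z (sub σ u)) (plug (lam t))
  reduct : sub σ (plugL L (es t (ren (wkL L) u))) ≡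
           plugL ctx (es (sub (liftS inner) t) (ren (wkL ctx) (sub σ u)))
  reduct = trans (plug _) (cong (λ z → plugL ctx (es (sub (liftS inner) t) z)) (sub-ren-square wk u))

s-sub : (σ : Fin n → Tm m) {a b : Tm n} → sR a b → sR (sub σ a) (sub σ b)
s-sub σ (s-rule t u) = subst (sR _) (sym (sub-sub0 σ t u)) (s-rule (sub (liftS σ) t) (sub σ u))

sV-sub : (σ : Fin n → Tm m) → (∀ x → Value (σ x)) → {a b : Tm n} → sVR a b → sVR (sub σ a) (sub σ b)
sV-sub σ vals (sV-rule t L v isv) =
  subst₂ sVR (sym redex) (sym reduct) (sV-rule (sub (liftS σ) t) ctx (sub inner v) (Value-sub (value vals) isv))
  where
  open SubstL (substL σ L)
  redex : sub σ (es t (plugL L v)) ≡ es (sub (liftS σ) t) (plugL ctx (sub inner v))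
  redex = cong (es (sub (liftS σ) t)) (plug v)
  reduct : sub σ (plugL L (sub0 (ren (liftR (wkL L)) t) v)) ≡
           plugL ctx (sub0 (ren (liftR (wkL ctx)) (sub (liftS σ) t)) (sub inner v))
  reduct = begin
    sub σ (plugL L (sub0 (ren (liftR (wkL L)) t) v))
      ≡⟨ plug _ ⟩
    plugL ctx (sub inner (sub0 (ren (liftR (wkL L)) t) v))
      ≡⟨ cong (plugL ctx) (sub-sub0 inner (ren (liftR (wkL L)) t) v) ⟩
    plugL ctx (sub0 (sub (liftS inner) (ren (liftR (wkL L)) t)) (sub inner v))
      ≡⟨ cong (λ z → plugL ctx (sub0 z (sub inner v))) (sub-ren-square (liftS-square wk) t) ⟩
    plugL ctx (sub0 (ren (liftR (wkL ctx)) (sub (liftS σ) t)) (sub inner v))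
      ∎
    where open ≡-Reasoning

CBNrule-sub : (σ : Fin n → Tm m) {a b : Tm n} → CBNrule a b → CBNrule (sub σ a) (sub σ b)
CBNrule-sub σ (dB r) = dB (dB-sub σ r)
CBNrule-sub σ (s r)  = s (s-sub σ r)

CBVrule-sub : (σ : Fin n → Tm m) → (∀ x → Value (σ x)) → {a b : Tm n} → CBVrule a b → CBVrule (sub σ a) (sub σ b)
CBVrule-sub σ vals (dB r) = dB (dB-sub σ r)
CBVrule-sub σ vals (sV r) = sV (sV-sub σ vals r)

-- Standard reductions, for any notion of surface step containing surface dB

module Standardisation
  (R : Rel) (_↝_ : Rel)
  (Substitutable : {n : ℕ} → Tm n → Set)
  (var-substitutable : {n : ℕ} (x : Fin n) → Substitutable (var x))
  (ren-substitutable : {n m : ℕ} (ρ : Fin n → Fin m) {t : Tm n} → Substitutable t → Substitutable (ren ρ t))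
  (↝-sub : {n m : ℕ} (σ : Fin n → Tm m) → (∀ x → Substitutable (σ x)) → {a b : Tm n} → a ↝ b → sub σ a ↝ sub σ b)
  (↝-appL : {n : ℕ} {t t' u : Tm n} → t ↝ t' → app t u ↝ app t' u)
  (↝-esL : {n : ℕ} {t t' : Tm (suc n)} {u : Tm n} → t ↝ t' → es t u ↝ es t' u)
  (dB⇒↝ : {n : ℕ} {a b : Tm n} → dBR a b → a ↝ b)
  (↝⇒Full : {n : ℕ} {a b : Tm n} → a ↝ b → Full R a b)
  where

  infix 4 _⇛_ _⇛ᶜ_ _⇛ᴸ_

  mutual
    data _⇛_ {n : ℕ} (t u : Tm n) : Set where
      std : {t₀ : Tm n} → Star _↝_ t t₀ → t₀ ⇛ᶜ u → t ⇛ u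

    data _⇛ᶜ_ : {n : ℕ} → Tm n → Tm n → Set where
      var : (x : Fin n) → var x ⇛ᶜ var x
      lam : {t t' : Tm (suc n)} → t ⇛ t' → lam t ⇛ᶜ lam t'
      app : {t t' u u' : Tm n} → t ⇛ t' → u ⇛ u' → app t u ⇛ᶜ app t' u'
      es  : {t t' : Tm (suc n)} {u u' : Tm n} → t ⇛ t' → u ⇛ u' → es t u ⇛ᶜ es t' u'

  ⇛ᶜ⇒⇛ : {t u : Tm n} → t ⇛ᶜ u → t ⇛ u
  ⇛ᶜ⇒⇛ = std ε

  ⇛-refl : (t : Tm n) → t ⇛ t
  ⇛-refl (var x)   = ⇛ᶜ⇒⇛ (var x)
  ⇛-refl (lam t)   = ⇛ᶜ⇒⇛ (lam (⇛-refl t))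
  ⇛-refl (app t u) = ⇛ᶜ⇒⇛ (app (⇛-refl t) (⇛-refl u))
  ⇛-refl (es t u)  = ⇛ᶜ⇒⇛ (es (⇛-refl t) (⇛-refl u))

  ↝*-⇛ : {t t₁ u : Tm n} → Star _↝_ t t₁ → t₁ ⇛ u → t ⇛ u
  ↝*-⇛ steps (std steps' d) = std (steps ◅◅ steps') d

  ↝-ren : (ρ : Fin n → Fin m) {a b : Tm n} → a ↝ b → ren ρ a ↝ ren ρ b
  ↝-ren ρ {a} {b} r =
    subst₂ _↝_ (sym (ren-as-sub ρ a)) (sym (ren-as-sub ρ b))
      (↝-sub (var ∘ ρ) (var-substitutable ∘ ρ) r)

  mutual
    ⇛-ren : (ρ : Fin n → Fin m) {t u : Tm n} → t ⇛ u → ren ρ t ⇛ ren ρ u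
    ⇛-ren ρ (std steps d) = ↝*-⇛ (gmap (ren ρ) (↝-ren ρ) steps) (⇛ᶜ-ren ρ d)

    ⇛ᶜ-ren : (ρ : Fin n → Fin m) {t u : Tm n} → t ⇛ᶜ u → ren ρ t ⇛ ren ρ u
    ⇛ᶜ-ren ρ (var x)   = ⇛ᶜ⇒⇛ (var (ρ x))
    ⇛ᶜ-ren ρ (lam d)   = ⇛ᶜ⇒⇛ (lam (⇛-ren (liftR ρ) d))
    ⇛ᶜ-ren ρ (app d e) = ⇛ᶜ⇒⇛ (app (⇛-ren ρ d) (⇛-ren ρ e))
    ⇛ᶜ-ren ρ (es d e)  = ⇛ᶜ⇒⇛ (es (⇛-ren (liftR ρ) d) (⇛-ren ρ e))

  ⇛-ren-≗ : {ρ ρ' : Fin n → Fin m} → ρ ≗ ρ' → {t u : Tm n} → t ⇛ u → ren ρ t ⇛ ren ρ' u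
  ⇛-ren-≗ {ρ = ρ} e {u = u} d = subst (ren ρ _ ⇛_) (ren-cong e u) (⇛-ren ρ d)

  liftS-substitutable : {σ : Fin n → Tm m} → (∀ x → Substitutable (σ x)) → ∀ x → Substitutable (liftS σ x)
  liftS-substitutable h zero    = var-substitutable zero
  liftS-substitutable h (suc x) = ren-substitutable suc (h x)

  liftS-⇛ : {σ σ' : Fin n → Tm m} → (∀ x → σ x ⇛ σ' x) → ∀ x → liftS σ x ⇛ liftS σ' x
  liftS-⇛ d zero    = ⇛-refl _
  liftS-⇛ d (suc x) = ⇛-ren suc (d x)

  mutual
    ⇛-sub : {σ σ' : Fin n → Tm m} → (∀ x → Substitutable (σ x)) → (∀ x → σ x ⇛ σ' x) →
            {t u : Tm n} → t ⇛ u → sub σ t ⇛ sub σ' u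
    ⇛-sub {σ = σ} h dσ (std steps d) = ↝*-⇛ (gmap (sub σ) (↝-sub σ h) steps) (⇛ᶜ-sub h dσ d)

    ⇛ᶜ-sub : {σ σ' : Fin n → Tm m} → (∀ x → Substitutable (σ x)) → (∀ x → σ x ⇛ σ' x) →
             {t u : Tm n} → t ⇛ᶜ u → sub σ t ⇛ sub σ' u
    ⇛ᶜ-sub h dσ (var x)   = dσ x
    ⇛ᶜ-sub h dσ (lam d)   = ⇛ᶜ⇒⇛ (lam (⇛-sub (liftS-substitutable h) (liftS-⇛ dσ) d))
    ⇛ᶜ-sub h dσ (app d e) = ⇛ᶜ⇒⇛ (app (⇛-sub h dσ d) (⇛-sub h dσ e))
    ⇛ᶜ-sub h dσ (es d e)  = ⇛ᶜ⇒⇛ (es (⇛-sub (liftS-substitutable h) (liftS-⇛ dσ) d) (⇛-sub h dσ e))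

  ⇛-sub0 : {t₀ t : Tm (suc n)} {u₀ u : Tm n} → Substitutable u₀ → t₀ ⇛ t → u₀ ⇛ u → sub0 t₀ u₀ ⇛ sub0 t u
  ⇛-sub0 {t₀ = t₀} {t} {u₀} {u} h d e =
    subst₂ _⇛_ (sym (sub0-σ₀ t₀ u₀)) (sym (sub0-σ₀ t u)) (⇛-sub hσ dσ d)
    where
    hσ : ∀ x → Substitutable (σ₀ u₀ x)
    hσ zero    = h
    hσ (suc x) = var-substitutable x
    dσ : ∀ x → σ₀ u₀ x ⇛ σ₀ u x
    dσ zero    = e
    dσ (suc x) = ⇛-refl (var x)

  data _⇛ᴸ_ {n : ℕ} : LCtx n m → LCtx n m → Set where
    hole : hole ⇛ᴸ hole
    esL  : {L L' : LCtx (suc n) m} {u u' : Tm n} → L ⇛ᴸ L' → u ⇛ u' → esL L u ⇛ᴸ esL L' u'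

  ⇛ᴸ-wkL : {L L' : LCtx n m} → L ⇛ᴸ L' → wkL L ≗ wkL L'
  ⇛ᴸ-wkL hole        x = refl
  ⇛ᴸ-wkL (esL dL du) x = ⇛ᴸ-wkL dL (suc x)

  ⇛-plugL : {L L' : LCtx n m} → L ⇛ᴸ L' → {t t' : Tm m} → t ⇛ t' → plugL L t ⇛ plugL L' t'
  ⇛-plugL hole        d = d
  ⇛-plugL (esL dL du) d = ⇛ᶜ⇒⇛ (es (⇛-plugL dL d) du)

  record PlugLInversion (a : Tm n) (L : LCtx n m) (x : Tm m) : Set where
    constructor inversion
    field
      L₀    : LCtx n m
      x₀    : Tm m
      steps : Star _↝_ a (plugL L₀ x₀)
      ctx⇛  : L₀ ⇛ᴸ L
      hole⇛ : x₀ ⇛ᶜ x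

  ⇛-plugL-inv : (L : LCtx n m) {a : Tm n} {x : Tm m} → a ⇛ plugL L x → PlugLInversion a L x
  ⇛-plugL-inv hole (std steps d) = inversion hole _ steps hole d
  ⇛-plugL-inv (esL L u) (std steps (es d du)) with ⇛-plugL-inv L d
  ... | inversion L₀ x₀ steps' dL dx =
    inversion (esL L₀ _) x₀ (steps ◅◅ gmap (λ z → es z _) ↝-esL steps') (esL dL du) dx

  ⇛-dB : {t a b : Tm n} → t ⇛ a → dBR a b → t ⇛ b
  ⇛-dB (std steps (app d e)) (dB-rule L c u) with ⇛-plugL-inv L d
  ... | inversion L₀ (lam c₀) steps' dL (lam dc) =
    ↝*-⇛ (steps ◅◅ gmap (λ z → app z _) ↝-appL steps' ◅◅ dB⇒↝ (dB-rule L₀ c₀ _) ◅ ε)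
      (⇛-plugL dL (⇛ᶜ⇒⇛ (es dc (⇛-ren-≗ (⇛ᴸ-wkL dL) e))))

  module Absorption (⇛-root : {n : ℕ} {t a b : Tm n} → t ⇛ a → R a b → t ⇛ b) where

    ⇛-absorb : {t a b : Tm n} → t ⇛ a → Full R a b → t ⇛ b
    ⇛-absorb d                     (root r) = ⇛-root d r
    ⇛-absorb (std steps (app d e)) (appL r) = std steps (app (⇛-absorb d r) e)
    ⇛-absorb (std steps (app d e)) (appR r) = std steps (app d (⇛-absorb e r))
    ⇛-absorb (std steps (lam d))   (lam r)  = std steps (lam (⇛-absorb d r))
    ⇛-absorb (std steps (es d e))  (esL r)  = std steps (es (⇛-absorb d r) e)
    ⇛-absorb (std steps (es d e))  (esR r)  = std steps (es d (⇛-absorb e r))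

    Full*⇒⇛ : {t u : Tm n} → Star (Full R) t u → t ⇛ u
    Full*⇒⇛ {t = t} = go (⇛-refl t)
      where
      go : {t a b : Tm n} → t ⇛ a → Star (Full R) a b → t ⇛ b
      go d ε        = d
      go d (r ◅ rs) = go (⇛-absorb d r) rs

  mutual
    ⇛⇒Full* : {t u : Tm n} → t ⇛ u → Star (Full R) t u
    ⇛⇒Full* (std steps d) = map ↝⇒Full steps ◅◅ ⇛ᶜ⇒Full* d

    ⇛ᶜ⇒Full* : {t u : Tm n} → t ⇛ᶜ u → Star (Full R) t u
    ⇛ᶜ⇒Full* (var x)   = ε
    ⇛ᶜ⇒Full* (lam d)   = gmap lam lam (⇛⇒Full* d)
    ⇛ᶜ⇒Full* (app d e) = gmap (λ z → app z _) appL (⇛⇒Full* d) ◅◅ gmap (app _) appR (⇛⇒Full* e)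
    ⇛ᶜ⇒Full* (es d e)  = gmap (λ z → es z _) esL (⇛⇒Full* d) ◅◅ gmap (es _) esR (⇛⇒Full* e)

-- Call-by-name

SurfN-sub : (σ : Fin n → Tm m) {a b : Tm n} → →S-CBN a b → →S-CBN (sub σ a) (sub σ b)
SurfN-sub σ (root r) = root (CBNrule-sub σ r)
SurfN-sub σ (appL r) = appL (SurfN-sub σ r)
SurfN-sub σ (lam r)  = lam (SurfN-sub (liftS σ) r)
SurfN-sub σ (esL r)  = esL (SurfN-sub (liftS σ) r)

SurfN⇒Full : {R : Rel} {a b : Tm n} → SurfN R a b → Full R a b
SurfN⇒Full (root r) = root r
SurfN⇒Full (appL r) = appL (SurfN⇒Full r)
SurfN⇒Full (lam r)  = lam (SurfN⇒Full r)
SurfN⇒Full (esL r)  = esL (SurfN⇒Full r)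

IntN⇒Full : {R : Rel} {a b : Tm n} → IntN R a b → Full R a b
IntN⇒Full (appR r) = appR r
IntN⇒Full (esR r)  = esR r
IntN⇒Full (appL r) = appL (IntN⇒Full r)
IntN⇒Full (lam r)  = lam (IntN⇒Full r)
IntN⇒Full (esL r)  = esL (IntN⇒Full r)

module N = Standardisation CBNrule →S-CBN (λ _ → ⊤) (λ _ → tt) (λ _ _ → tt) (λ σ _ → SurfN-sub σ)
                           appL esL (λ r → root (dB r)) SurfN⇒Full
open N using (std; var; lam; app; es)

cbn-⇛-root : {t a b : Tm n} → t N.⇛ a → CBNrule a b → t N.⇛ b
cbn-⇛-root d (dB r) = N.⇛-dB d r
cbn-⇛-root (std steps (es {t = t₀} {u = u₀} d e)) (s (s-rule t u)) =
  N.↝*-⇛ (steps ◅◅ root (s (s-rule t₀ u₀)) ◅ ε) (N.⇛-sub0 tt d e)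

mutual
  cbn-factor : {t u : Tm n} → t N.⇛ u → ((→S-CBN *) ⨾ (→I-CBN *)) t u
  cbn-factor (std steps d) with cbn-factorᶜ d
  ... | m , surface , internal = m , steps ◅◅ surface , internal

  cbn-factorᶜ : {t u : Tm n} → t N.⇛ᶜ u → ((→S-CBN *) ⨾ (→I-CBN *)) t u
  cbn-factorᶜ (var x) = _ , ε , ε
  cbn-factorᶜ (lam d) with cbn-factor d
  ... | m , surface , internal = lam m , gmap lam lam surface , gmap lam lam internal
  cbn-factorᶜ (app d e) with cbn-factor d
  ... | m , surface , internal =
    app m _ , gmap (λ z → app z _) appL surface ,
    gmap (λ z → app z _) appL internal ◅◅ gmap (app _) appR (N.⇛⇒Full* e)
  cbn-factorᶜ (es d e) with cbn-factor d
  ... | m , surface , internal =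
    es m _ , gmap (λ z → es z _) esL surface ,
    gmap (λ z → es z _) esL internal ◅◅ gmap (es _) esR (N.⇛⇒Full* e)

cbn-factorisation : (→F-CBN *) ≐ ((→S-CBN *) ⨾ (→I-CBN *))
cbn-factorisation t u =
  cbn-factor ∘ N.Absorption.Full*⇒⇛ cbn-⇛-root ,
  λ { (m , surface , internal) → map SurfN⇒Full surface ◅◅ map IntN⇒Full internal }

-- Call-by-value

SurfV-sub : (σ : Fin n → Tm m) → (∀ x → Value (σ x)) → {a b : Tm n} → →S-CBV a b → →S-CBV (sub σ a) (sub σ b)
SurfV-sub σ vals (root r) = root (CBVrule-sub σ vals r)
SurfV-sub σ vals (appL r) = appL (SurfV-sub σ vals r)
SurfV-sub σ vals (appR r) = appR (SurfV-sub σ vals r)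
SurfV-sub σ vals (esL r)  = esL (SurfV-sub (liftS σ) (liftS-Value vals) r)
SurfV-sub σ vals (esR r)  = esR (SurfV-sub σ vals r)

SurfV⇒Full : {R : Rel} {a b : Tm n} → SurfV R a b → Full R a b
SurfV⇒Full (root r) = root r
SurfV⇒Full (appL r) = appL (SurfV⇒Full r)
SurfV⇒Full (appR r) = appR (SurfV⇒Full r)
SurfV⇒Full (esL r)  = esL (SurfV⇒Full r)
SurfV⇒Full (esR r)  = esR (SurfV⇒Full r)

IntV⇒Full : {R : Rel} {a b : Tm n} → IntV R a b → Full R a b
IntV⇒Full (lam r)  = lam r
IntV⇒Full (appL r) = appL (IntV⇒Full r)
IntV⇒Full (appR r) = appR (IntV⇒Full r)
IntV⇒Full (esL r)  = esL (IntV⇒Full r)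
IntV⇒Full (esR r)  = esR (IntV⇒Full r)

module V = Standardisation CBVrule →S-CBV Value var Value-ren SurfV-sub appL esL (λ r → root (dB r)) SurfV⇒Full
open V using (std; var; lam; app; es; inversion)

Value-⇛ᶜ⁻¹ : {v₀ v : Tm n} → v₀ V.⇛ᶜ v → Value v → Value v₀
Value-⇛ᶜ⁻¹ (var x) _ = var x
Value-⇛ᶜ⁻¹ (lam d) _ = lam _

cbv-⇛-root : {t a b : Tm n} → t V.⇛ a → CBVrule a b → t V.⇛ b
cbv-⇛-root d (dB r) = V.⇛-dB d r
cbv-⇛-root (std steps (es {t = t₀} d e)) (sV (sV-rule t L v isv)) with V.⇛-plugL-inv L e
... | inversion L₀ v₀ steps' dL dv =
  V.↝*-⇛ (steps ◅◅ gmap (es t₀) esR steps' ◅◅ root (sV (sV-rule t₀ L₀ v₀ isv₀)) ◅ ε)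
    (V.⇛-plugL dL (V.⇛-sub0 isv₀ (V.⇛-ren-≗ (liftR-cong (V.⇛ᴸ-wkL dL)) d) (V.⇛ᶜ⇒⇛ dv)))
  where
  isv₀ : Value v₀
  isv₀ = Value-⇛ᶜ⁻¹ dv isv

mutual
  cbv-factor : {t u : Tm n} → t V.⇛ u → ((→S-CBV *) ⨾ (→I-CBV *)) t u
  cbv-factor (std steps d) with cbv-factorᶜ d
  ... | m , surface , internal = m , steps ◅◅ surface , internal

  cbv-factorᶜ : {t u : Tm n} → t V.⇛ᶜ u → ((→S-CBV *) ⨾ (→I-CBV *)) t u
  cbv-factorᶜ (var x) = _ , ε , ε
  cbv-factorᶜ (lam d) = _ , ε , gmap lam lam (V.⇛⇒Full* d)
  cbv-factorᶜ (app d e) with cbv-factor d | cbv-factor e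
  ... | m₁ , surface₁ , internal₁ | m₂ , surface₂ , internal₂ =
    app m₁ m₂ ,
    gmap (λ z → app z _) appL surface₁ ◅◅ gmap (app _) appR surface₂ ,
    gmap (λ z → app z _) appL internal₁ ◅◅ gmap (app _) appR internal₂
  cbv-factorᶜ (es d e) with cbv-factor d | cbv-factor e
  ... | m₁ , surface₁ , internal₁ | m₂ , surface₂ , internal₂ =
    es m₁ m₂ ,
    gmap (λ z → es z _) esL surface₁ ◅◅ gmap (es _) esR surface₂ ,
    gmap (λ z → es z _) esL internal₁ ◅◅ gmap (es _) esR internal₂

cbv-factorisation : (→F-CBV *) ≐ ((→S-CBV *) ⨾ (→I-CBV *))
cbv-factorisation t u =
  cbv-factor ∘ V.Absorption.Full*⇒⇛ cbv-⇛-root ,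
  λ { (m , surface , internal) → map SurfV⇒Full surface ◅◅ map IntV⇒Full internal }

theorem2 : ((→F-CBN *) ≐ ((→S-CBN *) ⨾ (→I-CBN *))) × ((→F-CBV *) ≐ ((→S-CBV *) ⨾ (→I-CBV *)))
theorem2 = cbn-factorisation , cbv-factorisation
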